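{- Let $k\in\mathbb{N}$ with $k\ge 3$ and let $n$ be a positive integer. There exists a bijection $$\vartheta\colon \mathcal{P}_k(n)\longrightarrow \mathcal{B}_k(n-1)$$ such that for every $\pi\in\mathcal{P}_k(n)$ and all $i,j$: $(i,j)$ is an arc of $\pi$ if and only if $(i,j-1)$ is an arc of $\vartheta(\pi)$.
   Context: Notation: $[m]=\{1,\dots,m\}$. A set partition of $[n]$ is represented as a diagram on the vertices $1,\dots,n$ (drawn on a horizontal line) whose arcs are the pairs $(i,j)$ with $i<j$ such that $i$ and $j$ lie in the same block and no element of that block lies strictly between them. Thus every vertex is the left endpoint of at most one arc and the right endpoint of at most one arc. Such a partition is $k$-noncrossing if there are no $k$ arcs $(i_1,j_1),\dots,(i_k,j_k)$ with $i_1<i_2<\dots<i_k<j_1<j_2<\dots<j_k$. $\mathcal{P}_k(n)$ denotes the set of $k$-noncrossing set partitions of $[n]$. A braid over $[m]$ is a set of arcs $(i,j)$ with $1\le i\le j\le m$ (an arc $(j,j)$ is a loop) such that every vertex is the left endpoint of at most one arc and the right endpoint of at most one arc, where a loop $(j,j)$ counts as both a left and a right endpoint at $j$. Here a vertex $j$ that is the right endpoint of an arc $(i,j)$ and the left endpoint of an arc $(j,h)$, $i<j<h$, has these two arcs regarded as crossing each other. A braid is $k$-noncrossing if there are no $k$ arcs $(i_1,j_1),\dots,(i_k,j_k)$ with $i_1<i_2<\dots<i_k\le j_1<j_2<\dots<j_k$. $\mathcal{B}_k(m)$ denotes the set of $k$-noncrossing braids over $[m]$ (with $\mathcal{B}_k(0)$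 consisting of the empty braid). -}

module Defs where

open import Data.Nat using (ℕ; zero; suc; _<_; _≤_)
open import Data.Bool using (Bool; true; false; T)
open import Data.Maybe using (Maybe; just; nothing)
open import Data.Vec using (Vec; []; _∷_)
open import Data.Fin as Fin using (Fin)
open import Data.Product using (Σ; _×_; ∃-syntax)
open import Relation.Binary.PropositionalEquality using (_≡_)
open import Relation.Nullary using (¬_)

-- An arc diagram on vertices 1..n, given as an n×n Boolean matrix:
-- row i-1, column j-1 is true iff (i , j) is an arc.
-- (A Vec-of-Vecs is a canonical representation of a set of pairs,
-- so propositional equality is equality of arc sets.)
ArcMatrix : ℕ → Set
ArcMatrix n = Vec (Vec Bool n) n

at : ∀ {A : Set} {n : ℕ} → Vec A n → ℕ → Maybe A
at []       _       = nothing
at (x ∷ xs) zero    = just x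
at (x ∷ xs) (suc i) = at xs i

arcB : ∀ {n : ℕ} → ArcMatrix n → ℕ → ℕ → Bool
arcB A zero    _       = false
arcB A (suc i) zero    = false
arcB A (suc i) (suc j) with at A i
... | nothing  = false
... | just row with at row j
...   | nothing = false
...   | just b  = b

IsArc : ∀ {n : ℕ} → ArcMatrix n → ℕ → ℕ → Set
IsArc A i j = T (arcB A i j)

LeftUnique : ∀ {n : ℕ} → ArcMatrix n → Set
LeftUnique A = ∀ {i j j′} → IsArc A i j → IsArc A i j′ → j ≡ j′

RightUnique : ∀ {n : ℕ} → ArcMatrix n → Set
RightUnique A = ∀ {i i′ j} → IsArc A i j → IsArc A i′ j → i ≡ i′

-- set partition of [n] as its diagram: arcs (i,j), i<j, unique endpoints
IsPartitionDiagram : ∀ {n : ℕ} → ArcMatrix n → Set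
IsPartitionDiagram A = (∀ {i j} → IsArc A i j → i < j) × LeftUnique A × RightUnique A

-- braid over [m]: arcs (i,j), i ≤ j (loops (j,j) allowed), unique endpoints;
-- a loop (j,j) is both a left and right endpoint at j, which LeftUnique /
-- RightUnique enforce automatically.
IsBraid : ∀ {n : ℕ} → ArcMatrix n → Set
IsBraid A = (∀ {i j} → IsArc A i j → i ≤ j) × LeftUnique A × RightUnique A

StrictlyIncreasing : {k : ℕ} → (Fin k → ℕ) → Set
StrictlyIncreasing f = ∀ r s → r Fin.< s → f r < f s

-- k arcs (i_1,j_1),...,(i_k,j_k) with i_1<...<i_k<j_1<...<j_k
-- (given monotonicity, i_k < j_1 is equivalent to all i_r < j_s)
PartitionKCrossing : (k : ℕ) → ∀ {n : ℕ} → ArcMatrix n → Set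
PartitionKCrossing k A =
  ∃[ is ] ∃[ js ] ((∀ (r : Fin k) → IsArc A (is r) (js r))
                   × StrictlyIncreasing is × StrictlyIncreasing js
                   × (∀ r s → is r < js s))

BraidKCrossing : (k : ℕ) → ∀ {n : ℕ} → ArcMatrix n → Set
BraidKCrossing k A =
  ∃[ is ] ∃[ js ] ((∀ (r : Fin k) → IsArc A (is r) (js r))
                   × StrictlyIncreasing is × StrictlyIncreasing js
                   × (∀ r s → is r ≤ js s))

𝒫 : ℕ → ℕ → Set
𝒫 k n = Σ (ArcMatrix n) λ A → IsPartitionDiagram A × ¬ PartitionKCrossing k A

ℬ : ℕ → ℕ → Set
ℬ k m = Σ (ArcMatrix m) λ A → IsBraid A × ¬ BraidKCrossing k A

-- A partition diagram has no arc ending at vertex 1, and every arc (i , j) has i < j.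
-- Moving each right endpoint one step to the left therefore gives an arc diagram on
-- [n-1] whose arcs satisfy i ≤ j, with loops exactly where the partition had arcs
-- (i , i+1).  Left and right endpoints stay unique, and a family of k arcs with
-- i₁ < … < iₖ < j₁ < … < jₖ becomes one with i₁ < … < iₖ ≤ j₁ - 1 < … < jₖ - 1, so
-- k-crossings correspond and the shift restricts to the required bijection.
module Submission where

open import Defs
open import Data.Nat using (ℕ; _≤_; _∸_)
open import Data.Product using (Σ; _×_; ∃-syntax; proj₁)
open import Relation.Binary.PropositionalEquality using (_≡_)
open import Function.Bundles using (_⇔_)

open import Data.Nat using (zero; suc; pred; _<_; z≤n; s≤s; s≤s⁻¹; >-nonZero)
open import Data.Nat.Properties
  using (suc-injective; ≤-<-trans; <-≤-trans; m≤n⇒m≤1+n; n≮0; <⇒≤pred; pred-mono-<)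
open import Data.Bool using (Bool; true; false; T)
open import Data.Maybe using (just; nothing; fromMaybe; maybe′)
open import Data.Vec using (Vec; []; _∷_)
open import Data.Product using (_,_; proj₂; map; map₁)
open import Data.Empty using (⊥-elim)
open import Relation.Binary.PropositionalEquality using (refl; sym; trans; cong; cong₂; subst; module ≡-Reasoning)
open import Relation.Nullary using (¬_)
open import Function.Base using (_∘_)
open import Function.Bundles using (mk⇔)

¬T⇒≡false : ∀ {b} → ¬ T b → b ≡ false
¬T⇒≡false {false} _  = refl
¬T⇒≡false {true}  ¬t = ⊥-elim (¬t _)

-- Entries of Boolean matrices, 0-indexed and false outside the matrix.

entryRow : ∀ {n} → Vec Bool n → ℕ → Bool
entryRow r j = fromMaybe false (at r j)

entry : ∀ {m n} → Vec (Vec Bool n) m → ℕ → ℕ → Bool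
entry A i j = maybe′ (λ r → entryRow r j) false (at A i)

arcB-suc : ∀ {n} (A : ArcMatrix n) i j → arcB A (suc i) (suc j) ≡ entry A i j
arcB-suc A i j with at A i
... | nothing = refl
... | just r with at r j
...   | nothing = refl
...   | just b  = refl

entryRow-ext : ∀ {n} (r r′ : Vec Bool n) → (∀ j → entryRow r j ≡ entryRow r′ j) → r ≡ r′
entryRow-ext []      []        _  = refl
entryRow-ext (x ∷ r) (x′ ∷ r′) eq = cong₂ _∷_ (eq zero) (entryRow-ext r r′ (eq ∘ suc))

entry-ext : ∀ {m n} (A A′ : Vec (Vec Bool n) m) → (∀ i j → entry A i j ≡ entry A′ i j) → A ≡ A′
entry-ext []      []        _  = refl
entry-ext (r ∷ A) (r′ ∷ A′) eq = cong₂ _∷_ (entryRow-ext r r′ (eq zero)) (entry-ext A A′ (eq ∘ suc))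

entryRow-bounded : ∀ {n} (r : Vec Bool n) j → T (entryRow r j) → j < n
entryRow-bounded (x ∷ r) zero    _ = s≤s z≤n
entryRow-bounded (x ∷ r) (suc j) t = s≤s (entryRow-bounded r j t)

entry-bounded : ∀ {m n} (A : Vec (Vec Bool n) m) i j → T (entry A i j) → i < m × j < n
entry-bounded (r ∷ A) zero    j t = s≤s z≤n , entryRow-bounded r j t
entry-bounded (r ∷ A) (suc i) j t = map₁ s≤s (entry-bounded A i j t)

arc-bounded : ∀ {n} (A : ArcMatrix n) i j → IsArc A i j → i ≤ n × j ≤ n
arc-bounded A (suc i) (suc j) a = entry-bounded A i j (subst T (arcB-suc A i j) a)

no-arc-to-0 : ∀ {n} (A : ArcMatrix n) i → ¬ IsArc A i 0
no-arc-to-0 A zero    ()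
no-arc-to-0 A (suc i) ()

tabulateRow : (n : ℕ) → (ℕ → Bool) → Vec Bool n
tabulateRow zero    g = []
tabulateRow (suc n) g = g zero ∷ tabulateRow n (g ∘ suc)

tabulateMatrix : (m n : ℕ) → (ℕ → ℕ → Bool) → Vec (Vec Bool n) m
tabulateMatrix zero    n f = []
tabulateMatrix (suc m) n f = tabulateRow n (f zero) ∷ tabulateMatrix m n (f ∘ suc)

entryRow-tabulate : ∀ n (g : ℕ → Bool) → (∀ j → T (g j) → j < n) →
                    ∀ j → entryRow (tabulateRow n g) j ≡ g j
entryRow-tabulate zero    g supp j       = sym (¬T⇒≡false (n≮0 ∘ supp j))
entryRow-tabulate (suc n) g supp zero    = refl
entryRow-tabulate (suc n) g supp (suc j) =
  entryRow-tabulate n (g ∘ suc) (λ j → s≤s⁻¹ ∘ supp (suc j)) j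

entry-tabulate : ∀ m n (f : ℕ → ℕ → Bool) → (∀ i j → T (f i j) → i < m × j < n) →
                 ∀ i j → entry (tabulateMatrix m n f) i j ≡ f i j
entry-tabulate zero    n f supp i       j = sym (¬T⇒≡false (n≮0 ∘ proj₁ ∘ supp i j))
entry-tabulate (suc m) n f supp zero    j = entryRow-tabulate n (f zero) (λ j → proj₂ ∘ supp zero j) j
entry-tabulate (suc m) n f supp (suc i) j =
  entry-tabulate m n (f ∘ suc) (λ i j → map₁ s≤s⁻¹ ∘ supp (suc i) j) i j

EndpointShift : ∀ {n m} → ArcMatrix n → ArcMatrix m → Set
EndpointShift A B = ∀ i j → arcB A i (suc j) ≡ arcB B i j

EndpointShift-uniqueˡ : ∀ {n m} {A A′ : ArcMatrix n} {B : ArcMatrix m} →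
                        EndpointShift A B → EndpointShift A′ B → A ≡ A′
EndpointShift-uniqueˡ {A = A} {A′} {B} sh sh′ = entry-ext A A′ λ i j → begin
  entry A i j              ≡⟨ sym (arcB-suc A i j) ⟩
  arcB A (suc i) (suc j)   ≡⟨ sh (suc i) j ⟩
  arcB B (suc i) j         ≡⟨ sym (sh′ (suc i) j) ⟩
  arcB A′ (suc i) (suc j)  ≡⟨ arcB-suc A′ i j ⟩
  entry A′ i j             ∎
  where open ≡-Reasoning

EndpointShift-uniqueʳ : ∀ {n m} {A : ArcMatrix n} {B B′ : ArcMatrix m} →
                        EndpointShift A B → EndpointShift A B′ → B ≡ B′
EndpointShift-uniqueʳ {A = A} {B} {B′} sh sh′ = entry-ext B B′ λ i j → begin
  entry B i j                    ≡⟨ sym (arcB-suc B i j) ⟩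
  arcB B (suc i) (suc j)         ≡⟨ sym (sh (suc i) (suc j)) ⟩
  arcB A (suc i) (suc (suc j))   ≡⟨ sh′ (suc i) (suc j) ⟩
  arcB B′ (suc i) (suc j)        ≡⟨ arcB-suc B′ i j ⟩
  entry B′ i j                   ∎
  where open ≡-Reasoning

module _ {n m} {A : ArcMatrix n} {B : ArcMatrix m} (shift : EndpointShift A B) where

  shift-arc : ∀ i j → IsArc A i (suc j) → IsArc B i j
  shift-arc i j = subst T (shift i j)

  unshift-arc : ∀ i j → IsArc B i j → IsArc A i (suc j)
  unshift-arc i j = subst T (sym (shift i j))

  arc⇔shifted-arc : IsPartitionDiagram A → ∀ i j → IsArc A i j ⇔ IsArc B i (j ∸ 1)
  arc⇔shifted-arc _ i (suc j) = mk⇔ (shift-arc i j) (unshift-arc i j)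
  arc⇔shifted-arc (lt , _) i zero =
    mk⇔ (⊥-elim ∘ no-arc-to-0 A i) (⊥-elim ∘ no-arc-to-1 i ∘ unshift-arc i 0)
    where
    no-arc-to-1 : ∀ i → ¬ IsArc A i 1
    no-arc-to-1 zero    ()
    no-arc-to-1 (suc i) a with lt a
    ... | s≤s ()

  isBraid : IsPartitionDiagram A → IsBraid B
  isBraid (lt , lu , ru) =
    (λ {i} {j} → s≤s⁻¹ ∘ lt ∘ unshift-arc i j) ,
    (λ {i} {j} {j′} b b′ → suc-injective (lu {i} (unshift-arc i j b) (unshift-arc i j′ b′))) ,
    (λ {i} {i′} {j} b b′ → ru {i} {i′} (unshift-arc i j b) (unshift-arc i′ j b′))

  isPartitionDiagram : IsBraid B → IsPartitionDiagram A
  isPartitionDiagram (le , lu , ru) =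
    (λ {i} {j} → lt i j) , (λ {i} {j} {j′} → lu′ i j j′) , (λ {i} {i′} {j} → ru′ i i′ j)
    where
    lt : ∀ i j → IsArc A i j → i < j
    lt i zero    a = ⊥-elim (no-arc-to-0 A i a)
    lt i (suc j) a = s≤s (le (shift-arc i j a))
    lu′ : ∀ i j j′ → IsArc A i j → IsArc A i j′ → j ≡ j′
    lu′ i zero    j′       a _  = ⊥-elim (no-arc-to-0 A i a)
    lu′ i (suc j) zero     _ a′ = ⊥-elim (no-arc-to-0 A i a′)
    lu′ i (suc j) (suc j′) a a′ = cong suc (lu {i} (shift-arc i j a) (shift-arc i j′ a′))
    ru′ : ∀ i i′ j → IsArc A i j → IsArc A i′ j → i ≡ i′
    ru′ i i′ zero    a _  = ⊥-elim (no-arc-to-0 A i a)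
    ru′ i i′ (suc j) a a′ = ru {i} {i′} (shift-arc i j a) (shift-arc i′ j a′)

  braidCrossing⇒partitionCrossing : ∀ k → BraidKCrossing k B → PartitionKCrossing k A
  braidCrossing⇒partitionCrossing k (is , js , arcs , is-inc , js-inc , is≤js) =
    is , suc ∘ js , (λ r → unshift-arc (is r) (js r) (arcs r)) , is-inc ,
    (λ r s → s≤s ∘ js-inc r s) , (λ r s → s≤s (is≤js r s))

  partitionCrossing⇒braidCrossing : ∀ k → PartitionKCrossing k A → BraidKCrossing k B
  partitionCrossing⇒braidCrossing k (is , js , arcs , is-inc , js-inc , is<js) =
    is , pred ∘ js , arcs′ , is-inc , js-inc′ , (λ r s → <⇒≤pred (is<js r s))
    where
    arcs′ : ∀ r → IsArc B (is r) (pred (js r))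
    arcs′ r with js r | arcs r
    ... | zero  | a = ⊥-elim (no-arc-to-0 A (is r) a)
    ... | suc j | a = shift-arc (is r) j a
    js-inc′ : StrictlyIncreasing (pred ∘ js)
    js-inc′ r s r<s = pred-mono-< {{>-nonZero (≤-<-trans z≤n (is<js r r))}} (js-inc r s r<s)

shiftLeft : ∀ {m} → ArcMatrix (suc m) → ArcMatrix m
shiftLeft {m} A = tabulateMatrix m m (λ i j → entry A i (suc j))

shiftRight : ∀ {m} → ArcMatrix m → ArcMatrix (suc m)
shiftRight {m} B = tabulateMatrix (suc m) (suc m) (λ i j → arcB B (suc i) j)

shiftRight-shift : ∀ {m} (B : ArcMatrix m) → EndpointShift (shiftRight B) B
shiftRight-shift B zero    j = refl
shiftRight-shift {m} B (suc i) j =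
  trans (arcB-suc (shiftRight B) i j) (entry-tabulate (suc m) (suc m) _ supp i j)
  where
  supp : ∀ i j → T (arcB B (suc i) j) → i < suc m × j < suc m
  supp i (suc j) = map m≤n⇒m≤1+n s≤s ∘ arc-bounded B (suc i) (suc j)

shiftLeft-shift : ∀ {m} (A : ArcMatrix (suc m)) → IsPartitionDiagram A → EndpointShift A (shiftLeft A)
shiftLeft-shift     A _        zero    j       = refl
shiftLeft-shift     A (lt , _) (suc i) zero    = ¬T⇒≡false λ a → n≮0 (s≤s⁻¹ (lt a))
shiftLeft-shift {m} A (lt , _) (suc i) (suc j) = begin
  arcB A (suc i) (suc (suc j))  ≡⟨ arcB-suc A i (suc j) ⟩
  entry A i (suc j)             ≡⟨ sym (entry-tabulate m m _ supp i j) ⟩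
  entry (shiftLeft A) i j       ≡⟨ sym (arcB-suc (shiftLeft A) i j) ⟩
  arcB (shiftLeft A) (suc i) (suc j) ∎
  where
  open ≡-Reasoning
  supp : ∀ i j → T (entry A i (suc j)) → i < m × j < m
  supp i j e = <-≤-trans (s≤s⁻¹ (lt arc)) j<m , j<m
    where
    arc : IsArc A (suc i) (suc (suc j))
    arc = subst T (sym (arcB-suc A i (suc j))) e
    j<m : j < m
    j<m = s≤s⁻¹ (proj₂ (entry-bounded A i (suc j) e))

-- The bijection is the same for every k.
theorem3p1 : (k n : ℕ) → 3 ≤ k → 1 ≤ n →
    Σ (𝒫 k n → ℬ k (n ∸ 1)) λ ϑ →
      (∀ (π σ : 𝒫 k n) → proj₁ (ϑ π) ≡ proj₁ (ϑ σ) → proj₁ π ≡ proj₁ σ)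
      × (∀ (β : ℬ k (n ∸ 1)) → ∃[ π ] (proj₁ (ϑ π) ≡ proj₁ β))
      × (∀ (π : 𝒫 k n) (i j : ℕ) → IsArc (proj₁ π) i j ⇔ IsArc (proj₁ (ϑ π)) i (j ∸ 1))
theorem3p1 k (suc m) _ _ = ϑ , injective , surjective , arcs
  where
  ϑ : 𝒫 k (suc m) → ℬ k m
  ϑ (A , pd , nc) = shiftLeft A , isBraid sh pd , nc ∘ braidCrossing⇒partitionCrossing sh k
    where
    sh : EndpointShift A (shiftLeft A)
    sh = shiftLeft-shift A pd

  injective : ∀ π σ → proj₁ (ϑ π) ≡ proj₁ (ϑ σ) → proj₁ π ≡ proj₁ σ
  injective (A , pd , _) (A′ , pd′ , _) eq =
    EndpointShift-uniqueˡ (shiftLeft-shift A pd) (subst (EndpointShift A′) (sym eq) (shiftLeft-shift A′ pd′))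

  surjective : ∀ β → ∃[ π ] (proj₁ (ϑ π) ≡ proj₁ β)
  surjective (B , braid , nc) =
    (shiftRight B , pd , nc ∘ partitionCrossing⇒braidCrossing sh k) ,
    EndpointShift-uniqueʳ (shiftLeft-shift (shiftRight B) pd) sh
    where
    sh : EndpointShift (shiftRight B) B
    sh = shiftRight-shift B
    pd : IsPartitionDiagram (shiftRight B)
    pd = isPartitionDiagram sh braid

  arcs : ∀ π i j → IsArc (proj₁ π) i j ⇔ IsArc (proj₁ (ϑ π)) i (j ∸ 1)
  arcs (A , pd , _) = arc⇔shifted-arc (shiftLeft-shift A pd) pd
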